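{- Let $H$ and $H'$ be two graphs with the same finite vertex set $V_H=V_{H'}=V$. Then $\mathrm{pPol}(E_H)\subseteq \mathrm{pPol}(E_{H'})$ if and only if $H=H'$ or $E_{H'}=\emptyset$.
   Context: All graphs are finite, simple, undirected and loopless; the edge set $E_H$ of a graph $H$ is viewed as a symmetric irreflexive binary relation on $V_H$. For a relation $R\subseteq V^n$, a partial function $f:\mathrm{dom}(f)\to V$ with $\mathrm{dom}(f)\subseteq V^m$ is a partial polymorphism of $R$ if for every $n\times m$ matrix $A$ over $V$ whose columns all belong to $R$ and whose rows all belong to $\mathrm{dom}(f)$, the column obtained by applying $f$ to each row belongs to $R$. $\mathrm{pPol}(R)$ denotes the set of all partial polymorphisms of $R$. -}

module Defs where

open import Data.Nat using (ℕ)
open import Data.Fin using (Fin; zero; suc)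
open import Data.Bool using (Bool; true; false)
open import Data.Maybe using (Maybe; just)
open import Relation.Binary.PropositionalEquality using (_≡_)

record Graph (k : ℕ) : Set where
  field
    adj   : Fin k → Fin k → Bool
    sym   : ∀ u v → adj u v ≡ adj v u
    irref : ∀ u → adj u u ≡ false
open Graph public

Rel : ℕ → Set → Set₁
Rel n V = (Fin n → V) → Set

PartialOp : ℕ → Set → Set
PartialOp m V = (Fin m → V) → Maybe V

-- f is a partial polymorphism of R: for every n×m matrix A (A i j = row i,
-- column j) whose columns lie in R and whose rows lie in dom f, the column
-- of values f(row i) lies in R.
IsPPol : ∀ {n m : ℕ} {V : Set} → Rel n V → PartialOp m V → Set
IsPPol {n} {m} {V} R f =
  (A : Fin n → Fin m → V) →
  (∀ j → R (λ i → A i j)) →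
  (b : Fin n → V) →
  (∀ i → f (A i) ≡ just (b i)) →
  R b

_⊆pPol_ : ∀ {n : ℕ} {V : Set} → Rel n V → Rel n V → Set
R ⊆pPol S = ∀ (m : ℕ) (f : PartialOp m _) → IsPPol R f → IsPPol S f

Edges : ∀ {k} → Graph k → Rel 2 (Fin k)
Edges H x = adj H (x zero) (x (suc zero)) ≡ true

SameGraph : ∀ {k} → Graph k → Graph k → Set
SameGraph H H' = ∀ u v → adj H u v ≡ adj H' u v

NoEdges : ∀ {k} → Graph k → Set
NoEdges H = ∀ u v → adj H u v ≡ false

{-# OPTIONS --safe #-}

-- A unary partial operation g is a partial polymorphism of a relation exactly
-- when it is a partial homomorphism, so pPol(E_H) ⊆ pPol(E_H') transfers
-- partial homomorphisms of H to H'. Apply this to the two-point map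
-- {x ↦ a, y ↦ b}: it is a partial homomorphism of H as soon as xy ∈ E_H implies
-- ab ∈ E_H, and then every H'-edge xy forces ab ∈ E_H'. With a = b = u and
-- uv ∉ E_H this would give a loop in H', so E_H' ⊆ E_H; and once H' has some
-- edge xy, every edge of H is an edge of H', so H = H'.
module Submission where

open import Defs hiding (sym)
open import Data.Nat using (ℕ; zero; suc)
open import Data.Fin using (Fin; zero; suc)
import Data.Fin as Fin
open import Data.Fin.Properties using (any?)
open import Data.Vec.Functional using ([]; _∷_)
open import Data.Bool using (true; false)
import Data.Bool as Bool
open import Data.Bool.Properties using (¬-not; ⇔→≡)
open import Data.Maybe using (Maybe; just; nothing)
open import Data.Sum using (_⊎_; inj₁; inj₂)
open import Data.Product using (_×_; _,_)
open import Data.Empty using (⊥-elim)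
open import Function.Bundles using (mk⇔)
open import Relation.Nullary using (¬_; yes; no; contradiction)
open import Relation.Binary.Definitions using (DecidableEquality)
open import Relation.Binary.PropositionalEquality
  using (_≡_; _≢_; refl; trans; sym)

module _ {n : ℕ} {V : Set} where

  unary : (V → Maybe V) → PartialOp 1 V
  unary g r = g (r zero)

  IsPartialHom : Rel n V → (V → Maybe V) → Set
  IsPartialHom R g = ∀ x y → (∀ i → g (x i) ≡ just (y i)) → R x → R y

  partialHom⇒pPol : ∀ {R g} → IsPartialHom R g → IsPPol R (unary g)
  partialHom⇒pPol hom A col b rows = hom (λ i → A i zero) b rows (col zero)

  pPol⇒partialHom : ∀ {R g} → IsPPol R (unary g) → IsPartialHom R g
  pPol⇒partialHom pp x y maps Rx = pp (λ i _ → x i) (λ _ → Rx) y maps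

  ⊆pPol⇒partialHom : ∀ {R S g} → R ⊆pPol S → IsPartialHom R g → IsPartialHom S g
  ⊆pPol⇒partialHom {g = g} R⊆S hom =
    pPol⇒partialHom {g = g} (R⊆S 1 (unary g) (partialHom⇒pPol {g = g} hom))

  ⊆pPol-resp-⇔ : ∀ {R S : Rel n V} → (∀ x → R x → S x) → (∀ x → S x → R x) → R ⊆pPol S
  ⊆pPol-resp-⇔ R⇒S S⇒R _ _ pp A col b rows = R⇒S b (pp A (λ j → S⇒R _ (col j)) b rows)

-- A nullary partial operation is a constant; it can only be a partial
-- polymorphism of a relation without constant tuples by being undefined.
⊆pPol-empty : ∀ {n} {V : Set} {R S : Rel (suc n) V} →
  (∀ c → ¬ R (λ _ → c)) → (∀ x → ¬ S x) → R ⊆pPol S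
⊆pPol-empty noConst _ zero _ pp A _ b rows =
  contradiction (pp (λ _ → A zero) (λ ()) (λ _ → b zero) (λ _ → rows zero)) (noConst (b zero))
⊆pPol-empty _ empty (suc _) _ _ _ col _ _ = contradiction (col zero) (empty _)

module TwoPointMap {V : Set} (_≟_ : DecidableEquality V) where

  twoPointMap : V → V → V → V → V → Maybe V
  twoPointMap x y a b w with w ≟ x | w ≟ y
  ... | yes _ | _     = just a
  ... | no _  | yes _ = just b
  ... | no _  | no _  = nothing

  module _ {x y a b : V} where

    twoPointMap-fst : twoPointMap x y a b x ≡ just a
    twoPointMap-fst with x ≟ x
    ... | yes _   = refl
    ... | no x≢x  = contradiction refl x≢x

    twoPointMap-snd : x ≢ y → twoPointMap x y a b y ≡ just b
    twoPointMap-snd x≢y with y ≟ x | y ≟ y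
    ... | yes y≡x | _      = contradiction (sym y≡x) x≢y
    ... | no _    | yes _  = refl
    ... | no _    | no y≢y = contradiction refl y≢y

    twoPointMap-defined : ∀ {w c} → twoPointMap x y a b w ≡ just c →
      (w ≡ x × c ≡ a) ⊎ (w ≡ y × c ≡ b)
    twoPointMap-defined {w} eq with w ≟ x | w ≟ y | eq
    ... | yes w≡x | _       | refl = inj₁ (w≡x , refl)
    ... | no _    | yes w≡y | refl = inj₂ (w≡y , refl)
    ... | no _    | no _    | ()

module _ {k : ℕ} where

  open TwoPointMap (Fin._≟_ {k})

  adj⇒≢ : ∀ (G : Graph k) {u v} → adj G u v ≡ true → u ≢ v
  adj⇒≢ G uv refl = contradiction (trans (sym uv) (irref G _)) λ ()

  twoPointMap-partialHom : ∀ (G : Graph k) {x y a b} →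
    (adj G x y ≡ true → adj G a b ≡ true) →
    IsPartialHom (Edges G) (twoPointMap x y a b)
  twoPointMap-partialHom G {x} {y} {a} {b} xy⇒ab _ _ maps =
    edge (twoPointMap-defined (maps zero)) (twoPointMap-defined (maps (suc zero)))
    where
    edge : ∀ {p q c d} → (p ≡ x × c ≡ a) ⊎ (p ≡ y × c ≡ b) →
      (q ≡ x × d ≡ a) ⊎ (q ≡ y × d ≡ b) → adj G p q ≡ true → adj G c d ≡ true
    edge (inj₁ (refl , _))    (inj₁ (refl , _))    xx = contradiction refl (adj⇒≢ G xx)
    edge (inj₁ (refl , refl)) (inj₂ (refl , refl)) xy = xy⇒ab xy
    edge (inj₂ (refl , refl)) (inj₁ (refl , refl)) yx =
      trans (Graph.sym G b a) (xy⇒ab (trans (Graph.sym G x y) yx))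
    edge (inj₂ (refl , _))    (inj₂ (refl , _))    yy = contradiction refl (adj⇒≢ G yy)

  module _ (H H' : Graph k) (H⊆H' : Edges H ⊆pPol Edges H') where

    ⊆pPol⇒edge-transfer : ∀ {x y a b} → adj H' x y ≡ true →
      (adj H x y ≡ true → adj H a b ≡ true) → adj H' a b ≡ true
    ⊆pPol⇒edge-transfer {x} {y} {a} {b} xy xy⇒ab =
      ⊆pPol⇒partialHom {R = Edges H} {Edges H'} {twoPointMap x y a b} H⊆H'
        (twoPointMap-partialHom H xy⇒ab) (x ∷ y ∷ []) (a ∷ b ∷ []) maps xy
      where
      maps : ∀ i → twoPointMap x y a b ((x ∷ y ∷ []) i) ≡ just ((a ∷ b ∷ []) i)
      maps zero       = twoPointMap-fst
      maps (suc zero) = twoPointMap-snd (adj⇒≢ H' xy)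

    ⊆pPol⇒adj'⇒adj : ∀ {u v} → adj H' u v ≡ true → adj H u v ≡ true
    ⊆pPol⇒adj'⇒adj {u} {v} uv with adj H u v in eq
    ... | true  = refl
    ... | false = ⊥-elim (adj⇒≢ H' uu refl)
      where
      uu : adj H' u u ≡ true
      uu = ⊆pPol⇒edge-transfer uv λ uv∈H → contradiction (trans (sym eq) uv∈H) λ ()

    ⊆pPol⇒adj⇒adj' : ∀ {x y u v} → adj H' x y ≡ true → adj H u v ≡ true → adj H' u v ≡ true
    ⊆pPol⇒adj⇒adj' xy uv = ⊆pPol⇒edge-transfer xy λ _ → uv

theorem3p1 : ∀ (k : ℕ) (H H' : Graph k) →
    ((Edges H ⊆pPol Edges H') → (SameGraph H H' ⊎ NoEdges H')) ×
    ((SameGraph H H' ⊎ NoEdges H') → (Edges H ⊆pPol Edges H'))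
theorem3p1 k H H' = forward , backward
  where
  forward : Edges H ⊆pPol Edges H' → SameGraph H H' ⊎ NoEdges H'
  forward H⊆H' with any? (λ x → any? (λ y → adj H' x y Bool.≟ true))
  ... | yes (x , y , xy) = inj₁ λ _ _ →
    ⇔→≡ (mk⇔ (⊆pPol⇒adj⇒adj' H H' H⊆H' xy) (⊆pPol⇒adj'⇒adj H H' H⊆H'))
  ... | no noEdge        = inj₂ λ x y → ¬-not λ xy → noEdge (x , y , xy)

  backward : SameGraph H H' ⊎ NoEdges H' → Edges H ⊆pPol Edges H'
  backward (inj₁ same) = ⊆pPol-resp-⇔ {R = Edges H} {Edges H'}
    (λ _ xy → trans (sym (same _ _)) xy) (λ _ xy → trans (same _ _) xy)
  backward (inj₂ none) = ⊆pPol-empty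
    (λ _ cc → adj⇒≢ H cc refl) (λ _ xy → contradiction (trans (sym xy) (none _ _)) λ ())
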